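{- Consider a stable matching instance with one-sided uncertainty in the comparison query model in which all agents of $A$ have the same preference list over $B$. Then there is a $1$-competitive algorithm that uses $\frac{n^2-n}{2}$ queries for finding a stable matching.
   Context: Two disjoint sets $A$, $B$ of agents with $|A|=|B|=n$. Each $a\in A$ has a strict total order $\prec_a$ on $B$ and each $b\in B$ has a strict total order $\prec_b$ on $A$ ($x\prec_y z$: $y$ prefers $x$ to $z$). A matching is a bijection between $A$ and $B$; it is stable if there is no pair $(a,b)$, $b\neq M(a)$, with $a$ preferring $b$ to $M(a)$ and $b$ preferring $a$ to $M(b)$. One-sided uncertainty: the orders $\prec_a$ ($a\in A$) are known, the orders $\prec_b$ ($b\in B$) are unknown and learned only via queries. A comparison query $\mathit{prefer}(b,a_1,a_2)$ returns whichever of $a_1,a_2$ agent $b$ prefers. An algorithm queries adaptively until the known information proves its output correct (for every consistent $B$-side preference profile). It is $\rho$-competitive if on every instance its number of queries is at most $\rho$ times the minimum size of a query set whose answers suffice to prove some correct output. -}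

module Defs where

open import Data.Nat using (ℕ; _≤_)
open import Data.Fin using (Fin; _<_; _≤?_)
open import Data.Fin.Permutation using (Permutation′; _⟨$⟩ʳ_; _⟨$⟩ˡ_)
open import Data.Bool using (Bool; true; false)
open import Data.List using (List; []; _∷_; length)
open import Data.List.Relation.Unary.All using (All)
open import Data.Product using (Σ; ∃; _×_; _,_; proj₁; proj₂)
open import Relation.Nullary using (¬_; does)
open import Relation.Binary.PropositionalEquality using (_≡_; _≢_)

-- A strict total order on a set of n agents, given as a ranking:
-- π ⟨$⟩ʳ x is the position of x (0 = most preferred); x ≺ y iff rank x < rank y.
Pref : ℕ → Set
Pref n = Permutation′ n

_≺⟨_⟩_ : ∀ {n} → Fin n → Pref n → Fin n → Set
x ≺⟨ π ⟩ y = (π ⟨$⟩ʳ x) < (π ⟨$⟩ʳ y)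

-- Agents A = Fin n, B = Fin n.
-- Known A-side profile: a ↦ order of a on B.  Unknown B-side profile: b ↦ order of b on A.
ProfileA : ℕ → Set
ProfileA n = Fin n → Pref n

ProfileB : ℕ → Set
ProfileB n = Fin n → Pref n

-- A matching: bijection M : A → B;  M ⟨$⟩ʳ a = M(a),  M ⟨$⟩ˡ b = M(b).
Matching : ℕ → Set
Matching n = Permutation′ n

BlockingPair : ∀ {n} → ProfileA n → ProfileB n → Matching n → Fin n → Fin n → Set
BlockingPair PA PB M a b =
  (b ≢ M ⟨$⟩ʳ a) × (b ≺⟨ PA a ⟩ (M ⟨$⟩ʳ a)) × (a ≺⟨ PB b ⟩ (M ⟨$⟩ˡ b))

Stable : ∀ {n} → ProfileA n → ProfileB n → Matching n → Set
Stable PA PB M = ∀ a b → ¬ BlockingPair PA PB M a b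

record Query (n : ℕ) : Set where
  constructor prefer
  field
    agent : Fin n
    first : Fin n
    second : Fin n

-- Answer: true  means  prefer(b,a₁,a₂) returns a₁ ; false means it returns a₂.
answer : ∀ {n} → ProfileB n → Query n → Bool
answer PB (prefer b a₁ a₂) = does ((PB b ⟨$⟩ʳ a₁) ≤? (PB b ⟨$⟩ʳ a₂))

data Alg (n : ℕ) : Set where
  output : Matching n → Alg n
  ask    : Query n → (Bool → Alg n) → Alg n

run : ∀ {n} → Alg n → ProfileB n → List (Query n) × Matching n
run (output M) PB = [] , M
run (ask q k) PB with run (k (answer PB q)) PB
... | qs , M = (q ∷ qs) , M

cost : ∀ {n} → Alg n → ProfileB n → ℕ
cost alg PB = length (proj₁ (run alg PB))

Consistent : ∀ {n} → ProfileB n → List (Query n) → ProfileB n → Set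
Consistent PB Q PB' = All (λ q → answer PB' q ≡ answer PB q) Q

Certificate : ∀ {n} → ProfileA n → ProfileB n → List (Query n) → Set
Certificate {n} PA PB Q = Σ (Matching n) λ M → ∀ PB' → Consistent PB Q PB' → Stable PA PB' M

-- Since all agents of A rank B identically, serial dictatorship in that order is stable: the agent of B
-- ranked k-th picks its favourite among the n − k agents of A not yet taken, with one comparison per
-- further candidate, n(n − 1)/2 queries in all.  Conversely, a certificate for a stable matching M must
-- contain, for every a and every b that a prefers to M(a), a query to b which a loses: otherwise moving a
-- to the top of b's list is consistent with all answers and makes (a , b) blocking.  These pairs (b , a)
-- are distinct and, because M(a) runs through all ranks, there are n(n − 1)/2 of them.
module Submission where

open import Defs
open import Data.Nat using (ℕ; zero; suc; _+_; _*_; _∸_; _/_; _≤_; z≤n; s≤s; s≤s⁻¹)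
import Data.Nat.Properties as ℕ
open import Data.Nat.DivMod using (m*n/n≡m)
open import Data.Nat.Tactic.RingSolver using (solve-∀)
open import Data.Fin using (Fin; zero; suc; _≟_; _≤?_; punchOut) renaming (_<_ to _<ᶠ_; _≤_ to _≤ᶠ_)
open import Data.Fin.Properties
  using (suc-injective; injective⇒≤; punchOut-cong; punchOut-mono-≤; punchOut-cancel-≤)
open import Data.Fin.Permutation
  using (Permutation′; _⟨$⟩ʳ_; _⟨$⟩ˡ_; _∘ₚ_; flip; transpose; insert; inverseˡ; inverseʳ) renaming (id to idₚ)
open import Data.Bool using (Bool; true; false; if_then_else_)
open import Data.List using (List; []; _∷_; _++_; map; length; lookup; allFin)
open import Data.List.Properties using (length-++; length-map; length-tabulate)
open import Data.List.Relation.Unary.All using (All; []; _∷_)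
import Data.List.Relation.Unary.All as All
open import Data.List.Relation.Unary.AllPairs using (AllPairs; []; _∷_)
open import Data.List.Relation.Unary.AllPairs.Properties using (tabulate⁺-<)
open import Data.List.Relation.Unary.Any using (here; there; index)
open import Data.List.Relation.Unary.Any.Properties using (lookup-index)
open import Data.List.Relation.Unary.Unique.Propositional using (Unique)
open import Data.List.Relation.Unary.Unique.Propositional.Properties using (++⁺; map⁺; allFin⁺)
open import Data.List.Relation.Binary.Disjoint.Propositional using (Disjoint)
open import Data.List.Relation.Binary.Subset.Propositional using (_⊆_)
open import Data.List.Membership.Propositional using (_∈_; _∉_)
open import Data.List.Membership.Propositional.Properties using (∈-lookup; ∈-map⁺; ∈-map⁻; ∈-++⁻; ∈-allFin)
import Data.List.Membership.DecPropositional as DecMembership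
open import Data.Product using (Σ; ∃; _×_; _,_; proj₁; proj₂)
import Data.Product as Product
open import Data.Product.Properties using (≡-dec)
open import Data.Sum using (_⊎_; inj₁; inj₂)
open import Data.Empty using (⊥-elim)
open import Function using (_∘_)
open import Function.Bundles using (Injection)
open import Function.Properties.Inverse using (↔⇒↣)
open import Relation.Nullary using (¬_; Dec; yes; no; does)
open import Relation.Nullary.Decidable using (dec-true; dec-false)
open import Relation.Binary.PropositionalEquality
  using (_≡_; _≢_; refl; sym; trans; cong; cong₂; subst; subst₂; module ≡-Reasoning)

triangular : ℕ → ℕ
triangular zero = 0
triangular (suc n) = n + triangular n

triangular-double : ∀ n → triangular n * 2 + n ≡ n * n
triangular-double zero = refl
triangular-double (suc n) = begin
  (n + triangular n) * 2 + suc n        ≡⟨ regroup n (triangular n) ⟩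
  suc (n + n) + (triangular n * 2 + n)  ≡⟨ cong (suc (n + n) +_) (triangular-double n) ⟩
  suc (n + n) + n * n                   ≡⟨ square-suc n ⟩
  suc n * suc n                         ∎
  where
  open ≡-Reasoning
  regroup : ∀ n t → (n + t) * 2 + suc n ≡ suc (n + n) + (t * 2 + n)
  regroup = solve-∀
  square-suc : ∀ n → suc (n + n) + n * n ≡ suc n * suc n
  square-suc = solve-∀

triangular-closed : ∀ n → (n * n ∸ n) / 2 ≡ triangular n
triangular-closed n = begin
  (n * n ∸ n) / 2                 ≡⟨ cong (λ m → (m ∸ n) / 2) (sym (triangular-double n)) ⟩
  (triangular n * 2 + n ∸ n) / 2  ≡⟨ cong (_/ 2) (ℕ.m+n∸n≡m (triangular n * 2) n) ⟩
  triangular n * 2 / 2            ≡⟨ m*n/n≡m (triangular n) 2 ⟩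
  triangular n                    ∎
  where open ≡-Reasoning

module _ {A : Set} where

  lookup-injective : ∀ {xs : List A} → Unique xs → ∀ {i j} → lookup xs i ≡ lookup xs j → i ≡ j
  lookup-injective (_ ∷ _)       {zero}  {zero}  _  = refl
  lookup-injective (x∉xs ∷ _)    {zero}  {suc j} eq = ⊥-elim (All.lookup x∉xs (∈-lookup j) eq)
  lookup-injective (x∉xs ∷ _)    {suc i} {zero}  eq = ⊥-elim (All.lookup x∉xs (∈-lookup i) (sym eq))
  lookup-injective (_ ∷ unique)  {suc i} {suc j} eq = cong suc (lookup-injective unique eq)

  Unique-⊆⇒length≤ : ∀ {xs ys : List A} → Unique xs → xs ⊆ ys → length xs ≤ length ys
  Unique-⊆⇒length≤ {xs} {ys} unique xs⊆ys = injective⇒≤ position-injective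
    where
    open ≡-Reasoning

    position : Fin (length xs) → Fin (length ys)
    position i = index (xs⊆ys (∈-lookup i))

    position-injective : ∀ {i j} → position i ≡ position j → i ≡ j
    position-injective {i} {j} eq = lookup-injective unique (begin
      lookup xs i             ≡⟨ lookup-index (xs⊆ys (∈-lookup i)) ⟩
      lookup ys (position i)  ≡⟨ cong (lookup ys) eq ⟩
      lookup ys (position j)  ≡⟨ lookup-index (xs⊆ys (∈-lookup j)) ⟨
      lookup xs j             ∎)

firstRow : ∀ {n} → Fin n → Fin (suc n) × Fin (suc n)
firstRow j = zero , suc j

shift : ∀ {n} → Fin n × Fin n → Fin (suc n) × Fin (suc n)
shift = Product.map suc suc

lowerTriangle : ∀ n → List (Fin n × Fin n)
lowerTriangle zero = []
lowerTriangle (suc n) = map firstRow (allFin n) ++ map shift (lowerTriangle n)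

length-lowerTriangle : ∀ n → length (lowerTriangle n) ≡ triangular n
length-lowerTriangle zero = refl
length-lowerTriangle (suc n) = begin
  length (map firstRow (allFin n) ++ map shift (lowerTriangle n))
    ≡⟨ length-++ (map firstRow (allFin n)) ⟩
  length (map firstRow (allFin n)) + length (map shift (lowerTriangle n))
    ≡⟨ cong₂ _+_ (trans (length-map _ (allFin n)) (length-tabulate _))
                 (trans (length-map _ (lowerTriangle n)) (length-lowerTriangle n)) ⟩
  n + triangular n ∎
  where open ≡-Reasoning

∈-lowerTriangle⇒< : ∀ {n k j} → (k , j) ∈ lowerTriangle n → k <ᶠ j
∈-lowerTriangle⇒< {suc n} kj∈ with ∈-++⁻ (map firstRow (allFin n)) kj∈
... | inj₁ kj∈first with _ , _ , refl ← ∈-map⁻ _ kj∈first = s≤s z≤n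
... | inj₂ kj∈shifted with _ , kj∈ , refl ← ∈-map⁻ _ kj∈shifted = s≤s (∈-lowerTriangle⇒< kj∈)

lowerTriangle-unique : ∀ n → Unique (lowerTriangle n)
lowerTriangle-unique zero = []
lowerTriangle-unique (suc n) =
  ++⁺ (map⁺ (suc-injective ∘ cong proj₂) (allFin⁺ n))
      (map⁺ shift-injective (lowerTriangle-unique n))
      firstRow-disjoint
  where
  shift-injective : ∀ {p q : Fin n × Fin n} → shift p ≡ shift q → p ≡ q
  shift-injective {_ , _} {_ , _} refl = refl

  firstRow-disjoint : Disjoint (map firstRow (allFin n)) (map shift (lowerTriangle n))
  firstRow-disjoint (p∈first , p∈shifted) with ∈-map⁻ _ p∈first | ∈-map⁻ _ p∈shifted
  ... | _ , _ , refl | (_ , _) , _ , ()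

module QueryTree {n : ℕ} where

  data Tree (X : Set) : Set where
    leaf : X → Tree X
    node : Query n → (Bool → Tree X) → Tree X

  private variable X Y : Set

  queries : Tree X → ProfileB n → List (Query n)
  queries (leaf _)   PB = []
  queries (node q k) PB = q ∷ queries (k (answer PB q)) PB

  result : Tree X → ProfileB n → X
  result (leaf x)   PB = x
  result (node q k) PB = result (k (answer PB q)) PB

  toAlg : (X → Matching n) → Tree X → Alg n
  toAlg f (leaf x)   = output (f x)
  toAlg f (node q k) = ask q (toAlg f ∘ k)

  run-toAlg : ∀ (f : X → Matching n) t PB → run (toAlg f t) PB ≡ (queries t PB , f (result t PB))
  run-toAlg f (leaf x)   PB = refl
  run-toAlg f (node q k) PB rewrite run-toAlg f (k (answer PB q)) PB = refl

  result-consistent : ∀ (t : Tree X) PB PB′ → Consistent PB (queries t PB) PB′ → result t PB′ ≡ result t PB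
  result-consistent (leaf x)   PB PB′ []          = refl
  result-consistent (node q k) PB PB′ (same ∷ c) rewrite same = result-consistent (k (answer PB q)) PB PB′ c

  _>>=_ : Tree X → (X → Tree Y) → Tree Y
  leaf x   >>= g = g x
  node q k >>= g = node q (λ r → k r >>= g)

  queries->>= : ∀ t (g : X → Tree Y) PB → queries (t >>= g) PB ≡ queries t PB ++ queries (g (result t PB)) PB
  queries->>= (leaf x)   g PB = refl
  queries->>= (node q k) g PB = cong (q ∷_) (queries->>= (k (answer PB q)) g PB)

  result->>= : ∀ t (g : X → Tree Y) PB → result (t >>= g) PB ≡ result (g (result t PB)) PB
  result->>= (leaf x)   g PB = refl
  result->>= (node q k) g PB = result->>= (k (answer PB q)) g PB

does≡true⇒ : ∀ {A : Set} (a? : Dec A) → does a? ≡ true → A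
does≡true⇒ (yes a) _ = a
does≡true⇒ (no _) ()

does≡false⇒¬ : ∀ {A : Set} (a? : Dec A) → does a? ≡ false → ¬ A
does≡false⇒¬ (yes _) ()
does≡false⇒¬ (no ¬a) _ = ¬a

answer≡true⇒≤ : ∀ {n} PB (b x y : Fin n) → answer PB (prefer b x y) ≡ true → PB b ⟨$⟩ʳ x ≤ᶠ PB b ⟨$⟩ʳ y
answer≡true⇒≤ PB b x y = does≡true⇒ ((PB b ⟨$⟩ʳ x) ≤? (PB b ⟨$⟩ʳ y))

answer≡false⇒> : ∀ {n} PB (b x y : Fin n) → answer PB (prefer b x y) ≡ false → PB b ⟨$⟩ʳ y <ᶠ PB b ⟨$⟩ʳ x
answer≡false⇒> PB b x y = ℕ.≰⇒> ∘ does≡false⇒¬ ((PB b ⟨$⟩ʳ x) ≤? (PB b ⟨$⟩ʳ y))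

module _ {n : ℕ} where
  open QueryTree {n}

  choose : {X : Set} → Fin n → (X → Fin n) → X → List X → Tree X
  choose b agentAt c []       = leaf c
  choose b agentAt c (x ∷ xs) =
    node (prefer b (agentAt c) (agentAt x)) λ keep → choose b agentAt (if keep then c else x) xs

  module _ {X : Set} (PB : ProfileB n) (b : Fin n) (agentAt : X → Fin n) where

    length-queries-choose : ∀ c xs → length (queries (choose b agentAt c xs) PB) ≡ length xs
    length-queries-choose c []       = refl
    length-queries-choose c (x ∷ xs) = cong suc (length-queries-choose _ xs)

    result-choose-∈ : ∀ c xs → result (choose b agentAt c xs) PB ∈ c ∷ xs
    result-choose-∈ c []       = here refl
    result-choose-∈ c (x ∷ xs) with answer PB (prefer b (agentAt c) (agentAt x))
    ... | true with result-choose-∈ c xs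
    ...   | here eq  = here eq
    ...   | there w∈ = there (there w∈)
    result-choose-∈ c (x ∷ xs) | false = there (result-choose-∈ x xs)

    private
      rank : X → Fin n
      rank x = PB b ⟨$⟩ʳ agentAt x

    result-choose-favourite : ∀ c xs {y} → y ∈ c ∷ xs → rank (result (choose b agentAt c xs) PB) ≤ᶠ rank y
    result-choose-favourite c [] (here refl) = ℕ.≤-refl
    result-choose-favourite c (x ∷ xs) y∈ with answer PB (prefer b (agentAt c) (agentAt x)) in eq
    ... | true with y∈
    ...   | here refl         = result-choose-favourite c xs (here refl)
    ...   | there (here refl) = ℕ.≤-trans (result-choose-favourite c xs (here refl)) (answer≡true⇒≤ PB b _ _ eq)
    ...   | there (there y∈′) = result-choose-favourite c xs (there y∈′)
    result-choose-favourite c (x ∷ xs) y∈ | false with y∈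
    ...   | here refl =
      ℕ.≤-trans (result-choose-favourite x xs (here refl)) (ℕ.<⇒≤ (answer≡false⇒> PB b _ _ eq))
    ...   | there y∈′ = result-choose-favourite x xs y∈′

module _ {n : ℕ} (s w : Fin n) where

  transpose-fixes : ∀ {y} → y ≢ s → y ≢ w → transpose s w ⟨$⟩ʳ y ≡ y
  transpose-fixes {y} y≢s y≢w with y ≟ s
  ... | yes y≡s = ⊥-elim (y≢s y≡s)
  ... | no _ with y ≟ w
  ...   | yes y≡w = ⊥-elim (y≢w y≡w)
  ...   | no _    = refl

  transpose-sends : transpose s w ⟨$⟩ʳ s ≡ w
  transpose-sends with s ≟ s
  ... | yes _   = refl
  ... | no s≢s = ⊥-elim (s≢s refl)

  transpose-image : ∀ y → transpose s w ⟨$⟩ʳ y ≡ s ⊎ transpose s w ⟨$⟩ʳ y ≡ w ⊎ transpose s w ⟨$⟩ʳ y ≡ y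
  transpose-image y with y ≟ s
  ... | yes _ = inj₂ (inj₁ refl)
  ... | no _ with y ≟ w
  ...   | yes _ = inj₁ refl
  ...   | no _  = inj₂ (inj₂ refl)

All<⇒∉ : ∀ {n} {s : Fin n} {ss} → All (s <ᶠ_) ss → s ∉ ss
All<⇒∉ s<ss s∈ss = ℕ.<-irrefl refl (All.lookup s<ss s∈ss)

-- Slot s of an arrangement τ is reserved for the s-th agent of B in the common order P;
-- τ ⟨$⟩ʳ s is the agent of A currently placed there.
module SerialDictatorship {n : ℕ} (P : Pref n) where
  open QueryTree {n}

  dictator : Fin n → Fin n
  dictator s = P ⟨$⟩ˡ s

  assign : Permutation′ n → List (Fin n) → Tree (Permutation′ n)
  assign τ []       = leaf τ
  assign τ (s ∷ ss) = choose (dictator s) (τ ⟨$⟩ʳ_) s ss >>= λ w → assign (transpose s w ∘ₚ τ) ss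

  toMatching : Permutation′ n → Matching n
  toMatching τ = flip (P ∘ₚ τ)

  serialDictatorship : Alg n
  serialDictatorship = toAlg toMatching (assign idₚ (allFin n))

  module _ (PB : ProfileB n) where

    choice : Permutation′ n → Fin n → List (Fin n) → Fin n
    choice τ s ss = result (choose (dictator s) (τ ⟨$⟩ʳ_) s ss) PB

    arrangement : Permutation′ n → List (Fin n) → Permutation′ n
    arrangement τ slots = result (assign τ slots) PB

    arrangement-∷ : ∀ τ s ss → arrangement τ (s ∷ ss) ≡ arrangement (transpose s (choice τ s ss) ∘ₚ τ) ss
    arrangement-∷ τ s ss = result->>= (choose (dictator s) (τ ⟨$⟩ʳ_) s ss) _ PB

    length-queries-assign : ∀ τ slots → length (queries (assign τ slots) PB) ≡ triangular (length slots)
    length-queries-assign τ [] = refl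
    length-queries-assign τ (s ∷ ss) = begin
      length (queries (assign τ (s ∷ ss)) PB)
        ≡⟨ cong length (queries->>= (choose (dictator s) (τ ⟨$⟩ʳ_) s ss) _ PB) ⟩
      length (queries (choose (dictator s) (τ ⟨$⟩ʳ_) s ss) PB ++ queries (assign τ′ ss) PB)
        ≡⟨ length-++ (queries (choose (dictator s) (τ ⟨$⟩ʳ_) s ss) PB) ⟩
      length (queries (choose (dictator s) (τ ⟨$⟩ʳ_) s ss) PB) + length (queries (assign τ′ ss) PB)
        ≡⟨ cong₂ _+_ (length-queries-choose PB (dictator s) (τ ⟨$⟩ʳ_) s ss) (length-queries-assign τ′ ss) ⟩
      length ss + triangular (length ss) ∎
      where
      open ≡-Reasoning
      τ′ = transpose s (choice τ s ss) ∘ₚ τ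

    arrangement-outside : ∀ τ slots {x} → x ∉ slots → arrangement τ slots ⟨$⟩ʳ x ≡ τ ⟨$⟩ʳ x
    arrangement-outside τ []       x∉ = refl
    arrangement-outside τ (s ∷ ss) {x} x∉ rewrite arrangement-∷ τ s ss
      | arrangement-outside (transpose s (choice τ s ss) ∘ₚ τ) ss (x∉ ∘ there) =
      cong (τ ⟨$⟩ʳ_) (transpose-fixes s (choice τ s ss) (x∉ ∘ here)
        (λ x≡w → x∉ (subst (_∈ s ∷ ss) (sym x≡w) (result-choose-∈ PB (dictator s) (τ ⟨$⟩ʳ_) s ss))))

    arrangement-head : ∀ τ s ss → All (s <ᶠ_) ss → arrangement τ (s ∷ ss) ⟨$⟩ʳ s ≡ τ ⟨$⟩ʳ choice τ s ss
    arrangement-head τ s ss s<ss rewrite arrangement-∷ τ s ss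
      | arrangement-outside (transpose s (choice τ s ss) ∘ₚ τ) ss (All<⇒∉ s<ss) =
      cong (τ ⟨$⟩ʳ_) (transpose-sends s (choice τ s ss))

    arrangement-within : ∀ τ slots → AllPairs _<ᶠ_ slots → ∀ {t} → t ∈ slots →
                         ∃ λ t′ → t′ ∈ slots × arrangement τ slots ⟨$⟩ʳ t ≡ τ ⟨$⟩ʳ t′
    arrangement-within τ (s ∷ ss) (s<ss ∷ _) (here refl) =
      choice τ s ss , result-choose-∈ PB (dictator s) (τ ⟨$⟩ʳ_) s ss , arrangement-head τ s ss s<ss
    arrangement-within τ (s ∷ ss) (_ ∷ sorted) {t} (there t∈)
      rewrite arrangement-∷ τ s ss
      with t″ , t″∈ , eq ← arrangement-within (transpose s (choice τ s ss) ∘ₚ τ) ss sorted t∈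
      with transpose-image s (choice τ s ss) t″
    ... | inj₁ eq′        = s , here refl , trans eq (cong (τ ⟨$⟩ʳ_) eq′)
    ... | inj₂ (inj₁ eq′) =
      choice τ s ss , result-choose-∈ PB (dictator s) (τ ⟨$⟩ʳ_) s ss , trans eq (cong (τ ⟨$⟩ʳ_) eq′)
    ... | inj₂ (inj₂ eq′) = t″ , there t″∈ , trans eq (cong (τ ⟨$⟩ʳ_) eq′)

    arrangement-preferred : ∀ τ slots → AllPairs _<ᶠ_ slots → ∀ {s t} → s ∈ slots → t ∈ slots → s <ᶠ t →
      PB (dictator s) ⟨$⟩ʳ (arrangement τ slots ⟨$⟩ʳ s) ≤ᶠ PB (dictator s) ⟨$⟩ʳ (arrangement τ slots ⟨$⟩ʳ t)
    arrangement-preferred τ (s ∷ ss) sorted (here refl) (here refl) s<t = ⊥-elim (ℕ.<-irrefl refl s<t)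
    arrangement-preferred τ (s ∷ ss) sorted@(s<ss ∷ _) (here refl) (there t∈)  _
      with t′ , t′∈ , eq ← arrangement-within τ (s ∷ ss) sorted (there t∈)
      rewrite arrangement-head τ s ss s<ss | eq =
      result-choose-favourite PB (dictator s) (τ ⟨$⟩ʳ_) s ss t′∈
    arrangement-preferred τ (s ∷ ss) (s<ss ∷ _) (there s∈) (here refl) s<t =
      ⊥-elim (ℕ.<-asym s<t (All.lookup s<ss s∈))
    arrangement-preferred τ (s ∷ ss) (_ ∷ sorted) (there s∈) (there t∈) s<t rewrite arrangement-∷ τ s ss =
      arrangement-preferred (transpose s (choice τ s ss) ∘ₚ τ) ss sorted s∈ t∈ s<t

  serialDictatorship-cost : ∀ PB → cost serialDictatorship PB ≡ triangular n
  serialDictatorship-cost PB = begin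
    cost serialDictatorship PB
      ≡⟨ cong (length ∘ proj₁) (run-toAlg toMatching (assign idₚ (allFin n)) PB) ⟩
    length (queries (assign idₚ (allFin n)) PB)
      ≡⟨ length-queries-assign PB idₚ (allFin n) ⟩
    triangular (length (allFin n))
      ≡⟨ cong triangular (length-tabulate {n = n} (λ i → i)) ⟩
    triangular n ∎
    where open ≡-Reasoning

  module _ (PA : ProfileA n) (common : ∀ a b → PA a ⟨$⟩ʳ b ≡ P ⟨$⟩ʳ b) where

    arrangement-stable : ∀ PB → Stable PA PB (toMatching (arrangement PB idₚ (allFin n)))
    arrangement-stable PB a b (_ , b≺Ma , a≺Mb) = ℕ.<⇒≱ a≺Mb b-prefers-partner
      where
      τ = arrangement PB idₚ (allFin n)
      s = P ⟨$⟩ʳ b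
      t = τ ⟨$⟩ˡ a

      s<t : s <ᶠ t
      s<t = subst₂ _<ᶠ_ (common a b) (trans (common a _) (inverseʳ P)) b≺Ma

      dictator-prefers : PB (dictator s) ⟨$⟩ʳ (τ ⟨$⟩ʳ s) ≤ᶠ PB (dictator s) ⟨$⟩ʳ (τ ⟨$⟩ʳ t)
      dictator-prefers =
        arrangement-preferred PB idₚ (allFin n) (tabulate⁺-< (λ i<j → i<j)) (∈-allFin s) (∈-allFin t) s<t

      b-prefers-partner : PB b ⟨$⟩ʳ (τ ⟨$⟩ʳ s) ≤ᶠ PB b ⟨$⟩ʳ a
      b-prefers-partner =
        subst₂ (λ b′ a′ → PB b′ ⟨$⟩ʳ (τ ⟨$⟩ʳ s) ≤ᶠ PB b′ ⟨$⟩ʳ a′) (inverseˡ P) (inverseʳ τ) dictator-prefers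

    serialDictatorship-correct : ∀ PB PB′ → Consistent PB (proj₁ (run serialDictatorship PB)) PB′ →
                                 Stable PA PB′ (proj₂ (run serialDictatorship PB))
    serialDictatorship-correct PB PB′ consistent rewrite run-toAlg toMatching (assign idₚ (allFin n)) PB =
      subst (Stable PA PB′ ∘ toMatching) (result-consistent (assign idₚ (allFin n)) PB PB′ consistent)
        (arrangement-stable PB′)

⟨$⟩ʳ-injective : ∀ {n} (π : Permutation′ n) {x y} → π ⟨$⟩ʳ x ≡ π ⟨$⟩ʳ y → x ≡ y
⟨$⟩ʳ-injective π = Injection.injective (↔⇒↣ π)

⟨$⟩ˡ-injective : ∀ {n} (π : Permutation′ n) {x y} → π ⟨$⟩ˡ x ≡ π ⟨$⟩ˡ y → x ≡ y
⟨$⟩ˡ-injective π = ⟨$⟩ʳ-injective (flip π)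

module _ {m : ℕ} (a : Fin (suc m)) (π : Pref (suc m)) where

  promote : Pref (suc m)
  promote = π ∘ₚ insert (π ⟨$⟩ʳ a) zero idₚ

  promote-top : promote ⟨$⟩ʳ a ≡ zero
  promote-top with π ⟨$⟩ʳ a ≟ π ⟨$⟩ʳ a
  ... | yes _    = refl
  ... | no πa≢πa = ⊥-elim (πa≢πa refl)

  promote-other : ∀ {x} (πa≢πx : π ⟨$⟩ʳ a ≢ π ⟨$⟩ʳ x) → promote ⟨$⟩ʳ x ≡ suc (punchOut πa≢πx)
  promote-other {x} πa≢πx with π ⟨$⟩ʳ a ≟ π ⟨$⟩ʳ x
  ... | yes πa≡πx = ⊥-elim (πa≢πx πa≡πx)
  ... | no _      = cong suc (punchOut-cong (π ⟨$⟩ʳ a) refl)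

  private
    π-moves : ∀ {x} → x ≢ a → π ⟨$⟩ʳ a ≢ π ⟨$⟩ʳ x
    π-moves x≢a = x≢a ∘ sym ∘ ⟨$⟩ʳ-injective π

  promote-top-< : ∀ {x} → x ≢ a → promote ⟨$⟩ʳ a <ᶠ promote ⟨$⟩ʳ x
  promote-top-< x≢a rewrite promote-top | promote-other (π-moves x≢a) = s≤s z≤n

  promote-mono-≤ : ∀ {x y} → x ≢ a → y ≢ a → π ⟨$⟩ʳ x ≤ᶠ π ⟨$⟩ʳ y → promote ⟨$⟩ʳ x ≤ᶠ promote ⟨$⟩ʳ y
  promote-mono-≤ x≢a y≢a x≤y rewrite promote-other (π-moves x≢a) | promote-other (π-moves y≢a) =
    s≤s (punchOut-mono-≤ (π-moves x≢a) (π-moves y≢a) x≤y)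

  promote-cancel-≤ : ∀ {x y} → x ≢ a → y ≢ a → promote ⟨$⟩ʳ x ≤ᶠ promote ⟨$⟩ʳ y → π ⟨$⟩ʳ x ≤ᶠ π ⟨$⟩ʳ y
  promote-cancel-≤ x≢a y≢a x≤y rewrite promote-other (π-moves x≢a) | promote-other (π-moves y≢a) =
    punchOut-cancel-≤ (π-moves x≢a) (π-moves y≢a) (s≤s⁻¹ x≤y)

  promote-keeps-comparison : ∀ {x y} (x≤?y : Dec (π ⟨$⟩ʳ x ≤ᶠ π ⟨$⟩ʳ y))
                             (x≤?′y : Dec (promote ⟨$⟩ʳ x ≤ᶠ promote ⟨$⟩ʳ y)) →
                             (if does x≤?y then y else x) ≢ a → does x≤?′y ≡ does x≤?y
  promote-keeps-comparison {x} {y} (yes x≤y) x≤?′y y≢a with x ≟ a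
  ... | yes refl = dec-true x≤?′y (subst (_≤ᶠ promote ⟨$⟩ʳ y) (sym promote-top) z≤n)
  ... | no x≢a   = dec-true x≤?′y (promote-mono-≤ x≢a y≢a x≤y)
  promote-keeps-comparison {x} {y} (no x≰y) x≤?′y x≢a with y ≟ a
  ... | yes refl = dec-false x≤?′y (ℕ.<⇒≱ (promote-top-< x≢a))
  ... | no y≢a   = dec-false x≤?′y (x≰y ∘ promote-cancel-≤ x≢a y≢a)

loser : ∀ {n} → ProfileB n → Query n → Fin n
loser PB q = if answer PB q then second q else first q
  where open Query

promoteAt : ∀ {m} → ProfileB (suc m) → Fin (suc m) → Fin (suc m) → ProfileB (suc m)
promoteAt PB b a b′ = if does (b′ ≟ b) then promote a (PB b′) else PB b′

answer-promoteAt : ∀ {m} PB (b a : Fin (suc m)) q → (Query.agent q , loser PB q) ≢ (b , a) →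
                   answer (promoteAt PB b a) q ≡ answer PB q
answer-promoteAt PB b a (prefer b′ x y) ≢ba with b′ ≟ b
... | no _     = refl
... | yes refl = promote-keeps-comparison a (PB b′) (PB b′ ⟨$⟩ʳ x ≤? PB b′ ⟨$⟩ʳ y)
                   (promote a (PB b′) ⟨$⟩ʳ x ≤? promote a (PB b′) ⟨$⟩ʳ y) (≢ba ∘ cong (b′ ,_))

witnessed : ∀ {n} → ProfileB n → Query n → Fin n × Fin n
witnessed PB q = Query.agent q , loser PB q

certificate-witnesses : ∀ {m} (PA : ProfileA (suc m)) PB Q ((M , certifies) : Certificate PA PB Q) {a b} →
                        b ≺⟨ PA a ⟩ (M ⟨$⟩ʳ a) → (b , a) ∈ map (witnessed PB) Q
certificate-witnesses PA PB Q (M , certifies) {a} {b} b≺Ma with (b , a) ∈? map (witnessed PB) Q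
  where open DecMembership (≡-dec _≟_ _≟_)
... | yes witness = witness
... | no missing  = ⊥-elim (certifies (promoteAt PB b a) consistent a b (b≢Ma , b≺Ma , a≺Mb))
  where
  consistent : Consistent PB Q (promoteAt PB b a)
  consistent = All.tabulate λ q∈Q →
    answer-promoteAt PB b a _ λ eq → missing (subst (_∈ _) eq (∈-map⁺ (witnessed PB) q∈Q))

  b≢Ma : b ≢ M ⟨$⟩ʳ a
  b≢Ma refl = ℕ.<-irrefl refl b≺Ma

  a≺Mb : a ≺⟨ promoteAt PB b a b ⟩ (M ⟨$⟩ˡ b)
  a≺Mb rewrite dec-true (b ≟ b) refl =
    promote-top-< a (PB b) λ Mb≡a → b≢Ma (trans (sym (inverseʳ M)) (cong (M ⟨$⟩ʳ_) Mb≡a))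

module _ {m : ℕ} (P : Pref (suc m)) (PA : ProfileA (suc m)) (common : ∀ a b → PA a ⟨$⟩ʳ b ≡ P ⟨$⟩ʳ b) where

  certificate-size : ∀ PB Q → Certificate PA PB Q → triangular (suc m) ≤ length Q
  certificate-size PB Q cert@(M , _) = begin
    triangular (suc m)                        ≡⟨ length-lowerTriangle (suc m) ⟨
    length (lowerTriangle (suc m))            ≡⟨ length-map required (lowerTriangle (suc m)) ⟨
    length (map required (lowerTriangle (suc m)))
      ≤⟨ Unique-⊆⇒length≤ (map⁺ required-injective (lowerTriangle-unique (suc m))) required-witnessed ⟩
    length (map (witnessed PB) Q)             ≡⟨ length-map (witnessed PB) Q ⟩
    length Q                                  ∎
    where
    open ℕ.≤-Reasoning

    -- The agent of B ranked k-th, and the agent of A whose partner is ranked j-th: for k < j the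
    -- latter prefers the former to its partner.
    required : Fin (suc m) × Fin (suc m) → Fin (suc m) × Fin (suc m)
    required (k , j) = P ⟨$⟩ˡ k , M ⟨$⟩ˡ (P ⟨$⟩ˡ j)

    required-injective : ∀ {p q} → required p ≡ required q → p ≡ q
    required-injective {_ , _} {_ , _} eq
      with refl ← ⟨$⟩ˡ-injective P (cong proj₁ eq)
         | refl ← ⟨$⟩ˡ-injective P (⟨$⟩ˡ-injective M (cong proj₂ eq)) = refl

    rank-of-ranked : ∀ a k → PA a ⟨$⟩ʳ (P ⟨$⟩ˡ k) ≡ k
    rank-of-ranked a k = trans (common a _) (inverseʳ P)

    required-witnessed : map required (lowerTriangle (suc m)) ⊆ map (witnessed PB) Q
    required-witnessed p∈ with (k , j) , kj∈ , refl ← ∈-map⁻ required p∈ =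
      certificate-witnesses PA PB Q cert
        (subst₂ _<ᶠ_ (sym (rank-of-ranked _ k))
                     (sym (trans (cong (PA _ ⟨$⟩ʳ_) (inverseʳ M)) (rank-of-ranked _ j)))
                     (∈-lowerTriangle⇒< kj∈))

mainTheorem3 : (n : ℕ) (PA : ProfileA n) →
    (∀ a a′ b → PA a ⟨$⟩ʳ b ≡ PA a′ ⟨$⟩ʳ b) →
    Σ (Alg n) λ alg →
      (∀ PB PB′ → Consistent PB (proj₁ (run alg PB)) PB′ → Stable PA PB′ (proj₂ (run alg PB)))
      × (∀ PB → cost alg PB ≡ (n * n ∸ n) / 2)
      × (∀ PB (Q : List (Query n)) → Certificate PA PB Q → cost alg PB ≤ 1 * length Q)
mainTheorem3 zero    PA _    = output idₚ , (λ _ _ _ ()) , (λ _ → refl) , (λ _ _ _ → z≤n)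
mainTheorem3 (suc m) PA same =
  serialDictatorship , serialDictatorship-correct PA common , optimal-cost , competitive
  where
  P : Pref (suc m)
  P = PA zero

  common : ∀ a b → PA a ⟨$⟩ʳ b ≡ P ⟨$⟩ʳ b
  common a = same a zero

  open SerialDictatorship P

  optimal-cost : ∀ PB → cost serialDictatorship PB ≡ (suc m * suc m ∸ suc m) / 2
  optimal-cost PB = trans (serialDictatorship-cost PB) (sym (triangular-closed (suc m)))

  competitive : ∀ PB Q → Certificate PA PB Q → cost serialDictatorship PB ≤ 1 * length Q
  competitive PB Q cert = begin
    cost serialDictatorship PB  ≡⟨ serialDictatorship-cost PB ⟩
    triangular (suc m)          ≤⟨ certificate-size P PA common PB Q cert ⟩
    length Q                    ≡⟨ ℕ.*-identityˡ (length Q) ⟨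
    1 * length Q                ∎
    where open ℕ.≤-Reasoning
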